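{- For every integer $k\ge 2$, every $\gamma\in(0,1]$ and every positive integer $n$ such that $\gamma n/2$ is an integer greater than $k$, there exists an $n$-vertex graph $G$ with minimum degree at least $\gamma n/2-(k+1)$ such that $\mathcal H_k(G,\gamma)$ is disconnected. Alternatively, for every integer $k\ge2$, every $\gamma\in(0,1]$ and every positive integer $n$ such that $\gamma n$ is an integer greater than $k$, there exists a balanced bipartite graph $G$ on $2n$ vertices with minimum degree at least $\lfloor(\gamma n-(k+1))/2\rfloor$ such that $\mathcal H_k(G,\gamma)$ is disconnected.
   Context: For an $n$-vertex graph $G$, $\mathcal H_k(G,\gamma)$ is the graph whose vertices are the matchings of $G$ in which exactly $\gamma n$ vertices are matched (i.e. with $\gamma n/2$ edges), two distinct such matchings $M_1,M_2$ being adjacent iff $|M_1\,\Delta\,M_2|\le 2k$. For a balanced bipartite graph $G$ on $2n$ vertices, $\mathcal H_k(G,\gamma)$ is defined in the same way on the matchings of $G$ with exactly $\gamma n$ edges. -}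

module Defs where

open import Data.Nat using (ℕ; zero; suc; _+_; _≤_; _<ᵇ_; _≡ᵇ_)
open import Data.Bool using (Bool; true; false; if_then_else_; not; _∧_; _xor_)
open import Data.Fin using (Fin; toℕ) renaming (zero to fz; suc to fs)
open import Data.Vec using (Vec; lookup)
open import Data.Product using (_×_)
open import Relation.Binary.PropositionalEquality using (_≡_)
open import Relation.Nullary using (¬_)
open import Relation.Binary.Construct.Closure.ReflexiveTransitive using (Star)

countB : ∀ {n} → (Fin n → Bool) → ℕ
countB {zero} f = 0
countB {suc n} f = (if f fz then 1 else 0) + countB (λ i → f (fs i))

sumF : ∀ {n} → (Fin n → ℕ) → ℕ
sumF {zero} f = 0
sumF {suc n} f = f fz + sumF (λ i → f (fs i))

record SimpleGraph (n : ℕ) : Set where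
  field
    adj   : Fin n → Fin n → Bool
    sym   : ∀ i j → adj i j ≡ adj j i
    irrfl : ∀ i → adj i i ≡ false
open SimpleGraph public

degree : ∀ {n} → SimpleGraph n → Fin n → ℕ
degree G i = countB (adj G i)

MinDegreeAtLeast : ∀ {n} → SimpleGraph n → ℕ → Set
MinDegreeAtLeast G d = ∀ i → d ≤ degree G i

-- An edge set on Fin n given by a Boolean adjacency matrix (a finite
-- datum, so _≡_ on it is extensional equality of edge sets).
EdgeSet : ℕ → Set
EdgeSet n = Vec (Vec Bool n) n

at : ∀ {n} → EdgeSet n → Fin n → Fin n → Bool
at M i j = lookup (lookup M i) j

IsMatching : ∀ {n} → SimpleGraph n → EdgeSet n → Set
IsMatching G M =
  (∀ i j → at M i j ≡ at M j i) ×
  (∀ i j → at M i j ≡ true → adj G i j ≡ true) ×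
  (∀ i → countB (at M i) ≤ 1)

matchedVertices : ∀ {n} → EdgeSet n → ℕ
matchedVertices M = countB (λ i → not (countB (at M i) ≡ᵇ 0))

symDiffSize : ∀ {n} → EdgeSet n → EdgeSet n → ℕ
symDiffSize M₁ M₂ =
  sumF (λ i → countB (λ j → (toℕ i <ᵇ toℕ j) ∧ (at M₁ i j xor at M₂ i j)))

-- vertices of H_k(G,γ) where γ n = v (the number of matched vertices)
IsHVertex : ∀ {n} → SimpleGraph n → ℕ → EdgeSet n → Set
IsHVertex G v M = IsMatching G M × (matchedVertices M ≡ v)

HAdj : ∀ {n} → SimpleGraph n → ℕ → ℕ → EdgeSet n → EdgeSet n → Set
HAdj G v k M₁ M₂ =
  IsHVertex G v M₁ × IsHVertex G v M₂ × ¬ (M₁ ≡ M₂) × (symDiffSize M₁ M₂ ≤ 2 Data.Nat.* k)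

HDisconnected : ∀ {n} → SimpleGraph n → ℕ → ℕ → Set
HDisconnected {n} G v k =
  Data.Product.Σ (EdgeSet n) λ M₁ → Data.Product.Σ (EdgeSet n) λ M₂ →
    IsHVertex G v M₁ × IsHVertex G v M₂ × ¬ Star (HAdj G v k) M₁ M₂

-- Balanced bipartite graphs on 2n vertices: parts Fin n (left), Fin n (right)

BipGraph : ℕ → Set
BipGraph n = Fin n → Fin n → Bool

degLeft : ∀ {n} → BipGraph n → Fin n → ℕ
degLeft G i = countB (G i)

degRight : ∀ {n} → BipGraph n → Fin n → ℕ
degRight G j = countB (λ i → G i j)

BipMinDegreeAtLeast : ∀ {n} → BipGraph n → ℕ → Set
BipMinDegreeAtLeast G d = (∀ i → d ≤ degLeft G i) × (∀ j → d ≤ degRight G j)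

-- M (left × right matrix) is a matching of G
IsBipMatching : ∀ {n} → BipGraph n → EdgeSet n → Set
IsBipMatching G M =
  (∀ i j → at M i j ≡ true → G i j ≡ true) ×
  (∀ i → countB (at M i) ≤ 1) ×
  (∀ j → countB (λ i → at M i j) ≤ 1)

bipEdges : ∀ {n} → EdgeSet n → ℕ
bipEdges M = sumF (λ i → countB (at M i))

bipSymDiffSize : ∀ {n} → EdgeSet n → EdgeSet n → ℕ
bipSymDiffSize M₁ M₂ = sumF (λ i → countB (λ j → at M₁ i j xor at M₂ i j))

-- vertices of H_k(G,γ) with γ n = e edges
IsBipHVertex : ∀ {n} → BipGraph n → ℕ → EdgeSet n → Set
IsBipHVertex G e M = IsBipMatching G M × (bipEdges M ≡ e)

BipHAdj : ∀ {n} → BipGraph n → ℕ → ℕ → EdgeSet n → EdgeSet n → Set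
BipHAdj G e k M₁ M₂ =
  IsBipHVertex G e M₁ × IsBipHVertex G e M₂ × ¬ (M₁ ≡ M₂) × (bipSymDiffSize M₁ M₂ ≤ 2 Data.Nat.* k)

BipHDisconnected : ∀ {n} → BipGraph n → ℕ → ℕ → Set
BipHDisconnected {n} G e k =
  Data.Product.Σ (EdgeSet n) λ M₁ → Data.Product.Σ (EdgeSet n) λ M₂ →
    IsBipHVertex G e M₁ × IsBipHVertex G e M₂ × ¬ Star (BipHAdj G e k) M₁ M₂

-- Both graphs consist of a cycle C of length 2(k + 1) and "hub" vertices supplying the minimum
-- degree.  A vertex weighting under which every edge weighs at least t (t = 2 with weight 1 on C
-- and 2 on the hubs; t = 1 in the bipartite case) has total weight t times the number of edges of
-- the matchings in H, so by complementary slackness each of them matches every vertex of C along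
-- C, i.e. restricts to one of the two perfect matchings of C.  These differ in 2(k + 1) > 2k edges,
-- so the restriction is constant on the components of H, and both restrictions occur.
module Submission where

open import Data.Nat using (ℕ; _≤_; _<_; _*_; _∸_; _+_; _/_)
open import Data.Product using (Σ; _×_)
open import Defs hiding (sym)

open import Algebra.Properties.CommutativeSemigroup using (interchange)
open import Data.Bool using (Bool; true; false; if_then_else_; not; _∧_; _xor_)
import Data.Bool.Properties as Bool
open import Data.Fin using (Fin; toℕ; fromℕ<) renaming (zero to fz; suc to fs)
import Data.Fin.Properties as Fin
open import Data.Nat using (zero; suc; z≤n; s≤s; s≤s⁻¹; z<s; _≡ᵇ_; _<ᵇ_)
open import Data.Nat.DivMod using (m/n≤m; m/n*n≤m)
open import Data.Nat.Properties
open import Data.Product using (_,_; proj₁; proj₂; map; map₂)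
open import Data.Sum using (_⊎_; inj₁; inj₂; swap)
open import Data.Vec using (tabulate; lookup)
open import Data.Vec.Properties using (lookup∘tabulate)
open import Function using (_∘_)
open import Function.Bundles using (Equivalence; mk⇔)
open import Relation.Binary.Construct.Closure.ReflexiveTransitive using (Star; fold)
open import Relation.Binary.Definitions using (tri<; tri≈; tri>)
open import Relation.Binary.PropositionalEquality
open import Relation.Nullary using (¬_; contradiction; Dec; yes; no; does)
open import Relation.Nullary.Decidable using (dec-true; dec-false; does-⇔; _×-dec_; _⊎-dec_; ¬?)

x+x≡2*x : ∀ x → x + x ≡ 2 * x
x+x≡2*x x = cong (x +_) (sym (+-identityʳ x))

1+k+[m∸[k+1]]≡m : ∀ {k m} → k < m → suc k + (m ∸ (k + 1)) ≡ m
1+k+[m∸[k+1]]≡m {k} {m} k<m =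
  trans (cong (_+ (m ∸ (k + 1))) (+-comm 1 k)) (m+[n∸m]≡n (subst (_≤ m) (+-comm 1 k) k<m))

ι : Bool → ℕ
ι b = if b then 1 else 0

countB≡sumF : ∀ {n} (f : Fin n → Bool) → countB f ≡ sumF (ι ∘ f)
countB≡sumF {zero}  f = refl
countB≡sumF {suc n} f = cong (ι (f fz) +_) (countB≡sumF (f ∘ fs))

sumF-cong : ∀ {n} {f g : Fin n → ℕ} → (∀ i → f i ≡ g i) → sumF f ≡ sumF g
sumF-cong {zero}  f≗g = refl
sumF-cong {suc n} f≗g = cong₂ _+_ (f≗g fz) (sumF-cong (f≗g ∘ fs))

countB-cong : ∀ {n} {f g : Fin n → Bool} → (∀ i → f i ≡ g i) → countB f ≡ countB g
countB-cong {f = f} {g} f≗g = begin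
  countB f       ≡⟨ countB≡sumF f ⟩
  sumF (ι ∘ f)   ≡⟨ sumF-cong (cong ι ∘ f≗g) ⟩
  sumF (ι ∘ g)   ≡⟨ countB≡sumF g ⟨
  countB g       ∎
  where open ≡-Reasoning

sumF-distrib-+ : ∀ {n} (f g : Fin n → ℕ) → sumF (λ i → f i + g i) ≡ sumF f + sumF g
sumF-distrib-+ {zero}  f g = refl
sumF-distrib-+ {suc n} f g = trans
  (cong (f fz + g fz +_) (sumF-distrib-+ (f ∘ fs) (g ∘ fs)))
  (interchange +-commutativeSemigroup (f fz) (g fz) (sumF (f ∘ fs)) (sumF (g ∘ fs)))

sumF-distrib-* : ∀ {n} c (f : Fin n → ℕ) → sumF (λ i → c * f i) ≡ c * sumF f
sumF-distrib-* {zero}  c f = sym (*-zeroʳ c)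
sumF-distrib-* {suc n} c f = trans
  (cong (c * f fz +_) (sumF-distrib-* c (f ∘ fs)))
  (sym (*-distribˡ-+ c (f fz) (sumF (f ∘ fs))))

sumF-zero : ∀ n → sumF {n} (λ _ → 0) ≡ 0
sumF-zero zero    = refl
sumF-zero (suc n) = sumF-zero n

sumF-comm : ∀ {n p} (f : Fin n → Fin p → ℕ) →
  sumF (λ i → sumF (f i)) ≡ sumF (λ j → sumF (λ i → f i j))
sumF-comm {zero}  {p} f = sym (sumF-zero p)
sumF-comm {suc n} {p} f = trans
  (cong (sumF (f fz) +_) (sumF-comm (f ∘ fs)))
  (sym (sumF-distrib-+ (f fz) (λ j → sumF (λ i → f (fs i) j))))

sumF-mono-≤ : ∀ {n} {f g : Fin n → ℕ} → (∀ i → f i ≤ g i) → sumF f ≤ sumF g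
sumF-mono-≤ {zero}  f≤g = z≤n
sumF-mono-≤ {suc n} f≤g = +-mono-≤ (f≤g fz) (sumF-mono-≤ (f≤g ∘ fs))

sumF-mono-≤-tight : ∀ {n} {f g : Fin n → ℕ} → (∀ i → f i ≤ g i) → sumF g ≤ sumF f →
  ∀ i → g i ≤ f i
sumF-mono-≤-tight {suc n} {f} {g} f≤g Σg≤Σf fz = +-cancelʳ-≤ (sumF (g ∘ fs)) (g fz) (f fz)
  (≤-trans Σg≤Σf (+-monoʳ-≤ (f fz) (sumF-mono-≤ (f≤g ∘ fs))))
sumF-mono-≤-tight {suc n} {f} {g} f≤g Σg≤Σf (fs i) = sumF-mono-≤-tight (f≤g ∘ fs)
  (+-cancelˡ-≤ (g fz) _ _ (≤-trans Σg≤Σf (+-monoˡ-≤ (sumF (f ∘ fs)) (f≤g fz)))) i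

sumF-lb-prefix : ∀ {n} (g : Fin n → ℕ) K d → K ≤ n → (∀ i → toℕ i < K → d ≤ g i) →
  K * d ≤ sumF g
sumF-lb-prefix g zero d _ _ = z≤n
sumF-lb-prefix {suc n} g (suc K) d (s≤s K≤n) d≤g =
  +-mono-≤ (d≤g fz z<s) (sumF-lb-prefix (g ∘ fs) K d K≤n (λ i → d≤g (fs i) ∘ s≤s))

countB-lb-interval : ∀ {n} (f : Fin n → Bool) lo N → lo + N ≤ n →
  (∀ j → lo ≤ toℕ j → toℕ j < lo + N → f j ≡ true) → N ≤ countB f
countB-lb-interval f zero zero _ _ = z≤n
countB-lb-interval {suc n} f zero (suc N) (s≤s N≤n) inside rewrite inside fz z≤n z<s =
  s≤s (countB-lb-interval (f ∘ fs) zero N N≤n (λ j _ j<N → inside (fs j) z≤n (s≤s j<N)))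
countB-lb-interval {suc n} f (suc lo) N (s≤s hi≤n) inside = m≤n⇒m≤o+n (ι (f fz))
  (countB-lb-interval (f ∘ fs) lo N hi≤n (λ j lo≤j j<hi → inside (fs j) (s≤s lo≤j) (s≤s j<hi)))

countB-ub-interval : ∀ {n} (f : Fin n → Bool) lo N →
  (∀ j → f j ≡ true → lo ≤ toℕ j × toℕ j < lo + N) → countB f ≤ N
countB-ub-interval {zero} f lo N inside = z≤n
countB-ub-interval {suc n} f zero N inside with f fz in e | N
... | true  | zero  = contradiction (proj₂ (inside fz e)) λ ()
... | true  | suc N = s≤s (countB-ub-interval (f ∘ fs) zero N
                         (λ j fj → z≤n , s≤s⁻¹ (proj₂ (inside (fs j) fj))))
... | false | N     = countB-ub-interval (f ∘ fs) zero N
                         (λ j fj → z≤n , <-trans (n<1+n (toℕ j)) (proj₂ (inside (fs j) fj)))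
countB-ub-interval {suc n} f (suc lo) N inside with f fz in e
... | true  = contradiction (proj₁ (inside fz e)) λ ()
... | false = countB-ub-interval (f ∘ fs) lo N
  (λ j fj → map s≤s⁻¹ s≤s⁻¹ (inside (fs j) fj))

countB-witness : ∀ {n} (f : Fin n → Bool) → 1 ≤ countB f → Σ (Fin n) λ j → f j ≡ true
countB-witness {suc n} f pos with f fz in e
... | true  = fz , e
... | false = map fs (λ fj → fj) (countB-witness (f ∘ fs) pos)

countB-pos : ∀ {n} (f : Fin n → Bool) j → f j ≡ true → 1 ≤ countB f
countB-pos f fz     fj rewrite fj = s≤s z≤n
countB-pos f (fs j) fj = m≤n⇒m≤o+n (ι (f fz)) (countB-pos (f ∘ fs) j fj)

countB-two : ∀ {n} (f : Fin n → Bool) j₁ j₂ → f j₁ ≡ true → f j₂ ≡ true → j₁ ≢ j₂ →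
  2 ≤ countB f
countB-two f fz      fz      _   _   j₁≢j₂ = contradiction refl j₁≢j₂
countB-two f fz      (fs j₂) fj₁ fj₂ _ rewrite fj₁ = s≤s (countB-pos (f ∘ fs) j₂ fj₂)
countB-two f (fs j₁) fz      fj₁ fj₂ _ rewrite fj₂ = s≤s (countB-pos (f ∘ fs) j₁ fj₁)
countB-two f (fs j₁) (fs j₂) fj₁ fj₂ j₁≢j₂ =
  m≤n⇒m≤o+n (ι (f fz)) (countB-two (f ∘ fs) j₁ j₂ fj₁ fj₂ (j₁≢j₂ ∘ cong fs))

countB≤1⇒unique : ∀ {n} (f : Fin n → Bool) → countB f ≤ 1 →
  ∀ {i j} → f i ≡ true → f j ≡ true → i ≡ j
countB≤1⇒unique f ≤1 {i} {j} fi fj with i Fin.≟ j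
... | yes i≡j = i≡j
... | no  i≢j = contradiction (≤-trans (countB-two f i j fi fj i≢j) ≤1) λ { (s≤s ()) }

unique⇒countB≤1 : ∀ {n} (f : Fin n → Bool) →
  (∀ {i j} → f i ≡ true → f j ≡ true → i ≡ j) → countB f ≤ 1
unique⇒countB≤1 {zero}  f unique = z≤n
unique⇒countB≤1 {suc n} f unique with f fz in e
... | true  = s≤s (countB-ub-interval (f ∘ fs) 0 0 (λ j fj → contradiction (unique e fj) λ ()))
... | false = unique⇒countB≤1 (f ∘ fs) (λ fi fj → Fin.suc-injective (unique fi fj))

sumF≡countB-nonzero : ∀ {n} (g : Fin n → ℕ) → (∀ i → g i ≤ 1) →
  sumF g ≡ countB (λ i → not (g i ≡ᵇ 0))
sumF≡countB-nonzero {zero}  g g≤1 = refl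
sumF≡countB-nonzero {suc n} g g≤1 with g fz | g≤1 fz
... | zero   | _       = sumF≡countB-nonzero (g ∘ fs) (g≤1 ∘ fs)
... | suc ._ | s≤s z≤n = cong suc (sumF≡countB-nonzero (g ∘ fs) (g≤1 ∘ fs))

nonzero⁺ : ∀ {c} → 1 ≤ c → not (c ≡ᵇ 0) ≡ true
nonzero⁺ (s≤s _) = refl

nonzero⁻ : ∀ c → not (c ≡ᵇ 0) ≡ true → 1 ≤ c
nonzero⁻ (suc _) _ = s≤s z≤n

does-true : ∀ {P : Set} (P? : Dec P) → does P? ≡ true → P
does-true (yes p) _ = p

ι-yes : ∀ {P : Set} (P? : Dec P) → P → ι (does P?) ≡ 1
ι-yes P? p = cong ι (dec-true P? p)

ι-no : ∀ {P : Set} (P? : Dec P) → ¬ P → ι (does P?) ≡ 0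
ι-no P? ¬p = cong ι (dec-false P? ¬p)

countB-does-ub : ∀ {n} {P : ℕ → Set} (P? : ∀ a → Dec (P a)) lo N →
  (∀ {a} → P a → lo ≤ a × a < lo + N) → countB {n} (λ i → does (P? (toℕ i))) ≤ N
countB-does-ub {n} P? lo N inside =
  countB-ub-interval {n} (λ i → does (P? (toℕ i))) lo N λ i Pi → inside (does-true (P? (toℕ i)) Pi)

-- Complementary slackness: counting each edge of f with weight u i + v j ≥ t gives
-- t·|f| ≤ Σ u·r + Σ v·q ≤ Σ u + Σ v ≤ t·|f|, so every inequality on the way is tight.
module CoverSlackness {n p} (f : Fin n → Fin p → Bool) (u : Fin n → ℕ) (v : Fin p → ℕ) (t : ℕ)
  (covers : ∀ {i j} → f i j ≡ true → t ≤ u i + v j)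
  (row≤1 : ∀ i → countB (f i) ≤ 1) (col≤1 : ∀ j → countB (λ i → f i j) ≤ 1)
  (light : sumF u + sumF v ≤ t * sumF (λ i → countB (f i))) where

  private
    r : Fin n → ℕ
    r i = countB (f i)

    q : Fin p → ℕ
    q j = countB (λ i → f i j)

    load : Fin n → ℕ
    load i = sumF (λ j → ι (f i j) * (u i + v j))

    sumF-ι* : ∀ {m} (g : Fin m → Bool) c → sumF (λ j → ι (g j) * c) ≡ c * countB g
    sumF-ι* g c = begin
      sumF (λ j → ι (g j) * c) ≡⟨ sumF-cong (λ j → *-comm (ι (g j)) c) ⟩
      sumF (λ j → c * ι (g j)) ≡⟨ sumF-distrib-* c (ι ∘ g) ⟩
      c * sumF (ι ∘ g)         ≡⟨ cong (c *_) (countB≡sumF g) ⟨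
      c * countB g             ∎
      where open ≡-Reasoning

    *≤1 : ∀ w {c} → c ≤ 1 → w * c ≤ w
    *≤1 w c≤1 = ≤-trans (*-monoʳ-≤ w c≤1) (≤-reflexive (*-identityʳ w))

    edge-load : ∀ i j → ι (f i j) * t ≤ ι (f i j) * (u i + v j)
    edge-load i j with f i j in fij
    ... | true  = *-monoʳ-≤ 1 (covers fij)
    ... | false = z≤n

    row-load : ∀ i → t * r i ≤ load i
    row-load i = subst (_≤ load i) (sumF-ι* (f i) t) (sumF-mono-≤ (edge-load i))

    double-count : sumF load ≡ sumF (λ i → u i * r i) + sumF (λ j → v j * q j)
    double-count = begin
      sumF load
        ≡⟨ sumF-cong (λ i → trans (sumF-cong (λ j → *-distribˡ-+ (ι (f i j)) (u i) (v j)))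
                                  (sumF-distrib-+ (λ j → ι (f i j) * u i) (λ j → ι (f i j) * v j))) ⟩
      sumF (λ i → sumF (λ j → ι (f i j) * u i) + sumF (λ j → ι (f i j) * v j))
        ≡⟨ sumF-distrib-+ (λ i → sumF (λ j → ι (f i j) * u i)) (λ i → sumF (λ j → ι (f i j) * v j)) ⟩
      sumF (λ i → sumF (λ j → ι (f i j) * u i)) + sumF (λ i → sumF (λ j → ι (f i j) * v j))
        ≡⟨ cong₂ _+_ (sumF-cong (λ i → sumF-ι* (f i) (u i)))
                     (trans (sumF-comm (λ i j → ι (f i j) * v j))
                            (sumF-cong (λ j → sumF-ι* (λ i → f i j) (v j)))) ⟩
      sumF (λ i → u i * r i) + sumF (λ j → v j * q j) ∎
      where open ≡-Reasoning

    Σur≤Σu : sumF (λ i → u i * r i) ≤ sumF u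
    Σur≤Σu = sumF-mono-≤ (λ i → *≤1 (u i) (row≤1 i))

    Σvq≤Σv : sumF (λ j → v j * q j) ≤ sumF v
    Σvq≤Σv = sumF-mono-≤ (λ j → *≤1 (v j) (col≤1 j))

    Σu+Σv≤Σtr : sumF u + sumF v ≤ sumF (λ i → t * r i)
    Σu+Σv≤Σtr = ≤-trans light (≤-reflexive (sym (sumF-distrib-* t r)))

    tight-load : ∀ i → load i ≤ t * r i
    tight-load = sumF-mono-≤-tight row-load (begin
      sumF load                                        ≡⟨ double-count ⟩
      sumF (λ i → u i * r i) + sumF (λ j → v j * q j)  ≤⟨ +-mono-≤ Σur≤Σu Σvq≤Σv ⟩
      sumF u + sumF v                                  ≤⟨ Σu+Σv≤Σtr ⟩
      sumF (λ i → t * r i)                             ∎)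
      where open ≤-Reasoning

    Σu≤Σur : sumF u ≤ sumF (λ i → u i * r i)
    Σu≤Σur = +-cancelʳ-≤ (sumF v) _ _ (begin
      sumF u + sumF v                                  ≤⟨ Σu+Σv≤Σtr ⟩
      sumF (λ i → t * r i)                             ≤⟨ sumF-mono-≤ row-load ⟩
      sumF load                                        ≡⟨ double-count ⟩
      sumF (λ i → u i * r i) + sumF (λ j → v j * q j)  ≤⟨ +-monoʳ-≤ _ Σvq≤Σv ⟩
      sumF (λ i → u i * r i) + sumF v                  ∎)
      where open ≤-Reasoning

  tight : ∀ {i j} → f i j ≡ true → u i + v j ≤ t
  tight {i} {j} fij = subst₂ _≤_ (weigh fij) (weigh fij) (sumF-mono-≤-tight (edge-load i)
    (≤-trans (tight-load i) (≤-reflexive (sym (sumF-ι* (f i) t)))) j)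
    where
    weigh : ∀ {b x} → b ≡ true → ι b * x ≡ x
    weigh refl = *-identityˡ _

  saturated : ∀ {i} → 1 ≤ u i → 1 ≤ countB (f i)
  saturated {i} 1≤u = n≢0⇒n>0 λ r≡0 → <⇒≱ 1≤u (begin
    u i        ≤⟨ sumF-mono-≤-tight (λ i → *≤1 (u i) (row≤1 i)) Σu≤Σur i ⟩
    u i * r i  ≡⟨ cong (u i *_) r≡0 ⟩
    u i * 0    ≡⟨ *-zeroʳ (u i) ⟩
    0          ∎)
    where open ≤-Reasoning

-- The cycle of length 2(k + 1) on two copies of {0, …, k}: a is joined to a and to a + 1 mod (k + 1).
CycleEdge : ℕ → ℕ → ℕ → Set
CycleEdge k a b = b ≡ a ⊎ (a < k × b ≡ suc a) ⊎ (a ≡ k × b ≡ 0)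

CycleEdge? : ∀ k a b → Dec (CycleEdge k a b)
CycleEdge? k a b = (b ≟ a) ⊎-dec (((a <? k) ×-dec (b ≟ suc a)) ⊎-dec ((a ≟ k) ×-dec (b ≟ 0)))

CycleEdge-≤ : ∀ {k a b} → a ≤ k → CycleEdge k a b → b ≤ k
CycleEdge-≤ a≤k (inj₁ refl)               = a≤k
CycleEdge-≤ _   (inj₂ (inj₁ (a<k , refl))) = a<k
CycleEdge-≤ _   (inj₂ (inj₂ (_ , refl)))   = z≤n

module CyclePerfectMatching (k : ℕ) (1≤k : 1 ≤ k) (E : ℕ → ℕ → Set)
  (col-unique : ∀ {a a' b} → E a b → E a' b → a ≡ a')
  (perfect : ∀ {a} → a ≤ k → Σ ℕ λ b → E a b × CycleEdge k a b) where

  private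
    diagonal-step : ∀ {t} → t < k → E (suc t) (suc t) → E t t
    diagonal-step t<k e with perfect (<⇒≤ t<k)
    ... | _ , e' , inj₁ refl              = e'
    ... | _ , e' , inj₂ (inj₁ (_ , refl)) = contradiction (col-unique e e') 1+n≢n
    ... | _ , e' , inj₂ (inj₂ (refl , _)) = contradiction t<k (<-irrefl refl)

    diagonal-below : ∀ {j} → E j j → j ≤ k → ∀ {t} → t ≤ j → E t t
    diagonal-below {zero}  e _   z≤n = e
    diagonal-below {suc j} e j<k t≤j+1 with m≤n⇒m<n∨m≡n t≤j+1
    ... | inj₂ refl  = e
    ... | inj₁ t<j+1 = diagonal-below (diagonal-step j<k e) (<⇒≤ j<k) (s≤s⁻¹ t<j+1)

    diagonal-top : E 0 0 → E k k
    diagonal-top e₀ with perfect ≤-refl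
    ... | _ , e , inj₁ refl                = e
    ... | _ , e , inj₂ (inj₁ (k<k , _))    = contradiction k<k (<-irrefl refl)
    ... | _ , e , inj₂ (inj₂ (_ , refl))   = contradiction (col-unique e e₀) (>⇒≢ 1≤k)

    shifted : ¬ E 0 0 → ∀ {t} → t < k → E t (suc t)
    shifted ¬e₀ {zero} 0<k with perfect z≤n
    ... | _ , e , inj₁ refl              = contradiction e ¬e₀
    ... | _ , e , inj₂ (inj₁ (_ , refl)) = e
    ... | _ , e , inj₂ (inj₂ (0≡k , _))  = contradiction 0≡k (<⇒≢ 1≤k)
    shifted ¬e₀ {suc t} t<k with perfect (<⇒≤ t<k)
    ... | _ , e , inj₁ refl              =
      contradiction (col-unique (shifted ¬e₀ (<-trans (n<1+n t) t<k)) e) (1+n≢n ∘ sym)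
    ... | _ , e , inj₂ (inj₁ (_ , refl)) = e
    ... | _ , e , inj₂ (inj₂ (refl , _)) = contradiction t<k (<-irrefl refl)

    no-diagonal : ¬ E 0 0 → ∀ {t} → t ≤ k → ¬ E t t
    no-diagonal ¬e₀ {zero}  _   = ¬e₀
    no-diagonal ¬e₀ {suc t} t<k e = 1+n≢n (sym (col-unique (shifted ¬e₀ t<k) e))

  diagonal : E 0 0 → ∀ {t} → t ≤ k → E t t
  diagonal e₀ = diagonal-below (diagonal-top e₀) ≤-refl

  off-diagonal : ¬ E 0 0 → ∀ {t} → t ≤ k → Σ ℕ λ b → E t b × b ≢ t
  off-diagonal ¬e₀ t≤k with perfect t≤k
  ... | _ , e , inj₁ refl                 = contradiction e (no-diagonal ¬e₀ t≤k)
  ... | _ , e , inj₂ (inj₁ (_ , refl))    = _ , e , 1+n≢n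
  ... | _ , e , inj₂ (inj₂ (refl , refl)) = _ , e , <⇒≢ 1≤k

Entry : ∀ {n} → (Fin n → Fin n → Bool) → ℕ → ℕ → Set
Entry {n} f a b = Σ (Fin n) λ i → Σ (Fin n) λ j → toℕ i ≡ a × toℕ j ≡ b × f i j ≡ true

Entry-col-unique : ∀ {n} {f : Fin n → Fin n → Bool} → (∀ j → countB (λ i → f i j) ≤ 1) →
  ∀ {a a' b} → Entry f a b → Entry f a' b → a ≡ a'
Entry-col-unique col≤1 (i , j , refl , refl , fij) (i' , j' , refl , j'≡j , fi'j')
  with refl ← Fin.toℕ-injective j'≡j = cong toℕ (countB≤1⇒unique _ (col≤1 j) fij fi'j')

xor-count≥2 : ∀ {n} (f g P : Fin n → Bool) → countB f ≤ 1 → countB g ≤ 1 →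
  ∀ {j j'} → f j ≡ true → g j' ≡ true → j ≢ j' → P j ≡ true → P j' ≡ true →
  2 ≤ countB (λ x → P x ∧ (f x xor g x))
xor-count≥2 f g P f≤1 g≤1 {j} {j'} fj gj' j≢j' Pj Pj' =
  countB-two _ j j' differs-at-j differs-at-j' j≢j'
  where
  false-elsewhere : ∀ (h : Fin _ → Bool) → countB h ≤ 1 → ∀ {x y} → h x ≡ true → x ≢ y → h y ≡ false
  false-elsewhere h h≤1 {y = y} hx x≢y with h y in hy
  ... | true  = contradiction (countB≤1⇒unique h h≤1 hx hy) x≢y
  ... | false = refl
  differs-at-j : (P j ∧ (f j xor g j)) ≡ true
  differs-at-j rewrite Pj | fj | false-elsewhere g g≤1 gj' (j≢j' ∘ sym) = refl
  differs-at-j' : (P j' ∧ (f j' xor g j')) ≡ true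
  differs-at-j' rewrite Pj' | gj' | false-elsewhere f f≤1 fj j≢j' = refl

-- By CyclePerfectMatching, a matching M restricts to the diagonal or the rotated perfect
-- matching of the cycle, according to whether M has the entry (0 , off).  Matchings of the two
-- kinds differ twice in each of the k + 1 cycle rows, so they are more than 2k edges apart.
-- P selects the entries counted by the symmetric difference (i < j for simple graphs).
module CycleSeparation {n} (k off : ℕ) (1≤k : 1 ≤ k) (k<n : k < n) (off<n : off < n)
  (Vertex : EdgeSet n → Set)
  (row≤1 : ∀ M → Vertex M → ∀ i → countB (at M i) ≤ 1)
  (col≤1 : ∀ M → Vertex M → ∀ j → countB (λ i → at M i j) ≤ 1)
  (perfect : ∀ M → Vertex M → ∀ {a} → a ≤ k →
               Σ ℕ λ b → Entry (at M) a (off + b) × CycleEdge k a b)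
  (P : Fin n → Fin n → Bool) (P-holds : ∀ {i j} → toℕ i ≤ k → off ≤ toℕ j → P i j ≡ true) where

  private
    E : EdgeSet n → ℕ → ℕ → Set
    E M a b = Entry (at M) a (off + b)

    module Cycle M (vM : Vertex M) =
      CyclePerfectMatching k 1≤k (E M) (Entry-col-unique (col≤1 M vM)) (perfect M vM)

    0<n : 0 < n
    0<n = ≤-<-trans z≤n off<n

    origin : EdgeSet n → Bool
    origin M = at M (fromℕ< 0<n) (fromℕ< off<n)

    origin-true : ∀ M → origin M ≡ true → E M 0 0
    origin-true M o =
      _ , _ , Fin.toℕ-fromℕ< 0<n , trans (Fin.toℕ-fromℕ< off<n) (sym (+-identityʳ off)) , o

    origin-false : ∀ M → origin M ≡ false → ¬ E M 0 0
    origin-false M o (i , j , i≡0 , j≡off , Mij)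
      with refl ← Fin.toℕ-injective (trans i≡0 (sym (Fin.toℕ-fromℕ< 0<n)))
         | refl ← Fin.toℕ-injective (trans j≡off (trans (+-identityʳ off) (sym (Fin.toℕ-fromℕ< off<n))))
      = contradiction (trans (sym Mij) o) λ ()

    split-row : ∀ M M' → Vertex M → Vertex M' → origin M ≢ origin M' →
      ∀ {t} → t ≤ k → Σ ℕ λ b → Σ ℕ λ b' → E M t b × E M' t b' × b ≢ b'
    split-row M M' vM vM' o≢o' t≤k with origin M in o | origin M' in o'
    ... | true  | true  = contradiction refl o≢o'
    ... | false | false = contradiction refl o≢o'
    ... | true  | false = let b' , e' , b'≢t = Cycle.off-diagonal M' vM' (origin-false M' o') t≤k
                          in _ , b' , Cycle.diagonal M vM (origin-true M o) t≤k , e' , b'≢t ∘ sym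
    ... | false | true  = let b , e , b≢t = Cycle.off-diagonal M vM (origin-false M o) t≤k
                          in b , _ , e , Cycle.diagonal M' vM' (origin-true M' o') t≤k , b≢t

    row-differs : ∀ M M' → Vertex M → Vertex M' → origin M ≢ origin M' →
      ∀ i → toℕ i ≤ k → 2 ≤ countB (λ j → P i j ∧ (at M i j xor at M' i j))
    row-differs M M' vM vM' o≢o' i i≤k
      with split-row M M' vM vM' o≢o' i≤k
    ... | b , b' , (i₁ , j , i₁≡i , j≡ , Mij) , (i₂ , j' , i₂≡i , j'≡ , M'ij') , b≢b'
      with refl ← Fin.toℕ-injective i₁≡i | refl ← Fin.toℕ-injective i₂≡i
      = xor-count≥2 _ _ (P i₁) (row≤1 M vM i₁) (row≤1 M' vM' i₁) Mij M'ij'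
          (λ j≡j' → b≢b' (+-cancelˡ-≡ off b b' (trans (sym j≡) (trans (cong toℕ j≡j') j'≡))))
          (P-holds i≤k (subst (off ≤_) (sym j≡) (m≤m+n off b)))
          (P-holds i≤k (subst (off ≤_) (sym j'≡) (m≤m+n off b')))

    origin-invariant : ∀ M M' → Vertex M → Vertex M' →
      sumF (λ i → countB (λ j → P i j ∧ (at M i j xor at M' i j))) ≤ 2 * k → origin M ≡ origin M'
    origin-invariant M M' vM vM' small with origin M Bool.≟ origin M'
    ... | yes o≡o' = o≡o'
    ... | no  o≢o' = contradiction
      (≤-trans (sumF-lb-prefix _ (suc k) 2 k<n λ i i≤k → row-differs M M' vM vM' o≢o' i (s≤s⁻¹ i≤k))
               small)
      (<⇒≱ (m≤n⇒m≤1+n (s≤s (≤-reflexive (*-comm 2 k)))))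

  disconnected : ∀ {ℓ} {Close : EdgeSet n → EdgeSet n → Set ℓ} →
    (∀ {M M'} → Close M M' →
      Vertex M × Vertex M' × sumF (λ i → countB (λ j → P i j ∧ (at M i j xor at M' i j))) ≤ 2 * k) →
    ∀ {M M'} → Entry (at M) 0 off → ¬ Entry (at M') 0 off → ¬ Star Close M M'
  disconnected bound {M} {M'} e ¬e' path = distinct (fold (λ M M' → origin M ≡ origin M')
    (λ c → let vM , vM' , small = bound c in trans (origin-invariant _ _ vM vM' small)) refl path)
    where
    distinct : origin M ≢ origin M'
    distinct o≡o' with origin M in o
    ... | true  = ¬e' (subst (Entry (at M') 0) (+-identityʳ off) (origin-true M' (sym o≡o')))
    ... | false = origin-false M o (subst (Entry (at M) 0) (sym (+-identityʳ off)) e)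

edgeSet : ∀ {n} {R : ℕ → ℕ → Set} → (∀ a b → Dec (R a b)) → EdgeSet n
edgeSet R? = tabulate λ i → tabulate λ j → does (R? (toℕ i) (toℕ j))

module _ {n} {R : ℕ → ℕ → Set} (R? : ∀ a b → Dec (R a b)) {i j : Fin n} where

  at-edgeSet : at (edgeSet R?) i j ≡ does (R? (toℕ i) (toℕ j))
  at-edgeSet = trans (cong (λ row → lookup row j) (lookup∘tabulate _ i)) (lookup∘tabulate _ j)

  edgeSet⁺ : R (toℕ i) (toℕ j) → at (edgeSet R?) i j ≡ true
  edgeSet⁺ r = trans at-edgeSet (dec-true (R? (toℕ i) (toℕ j)) r)

  edgeSet⁻ : at (edgeSet R?) i j ≡ true → R (toℕ i) (toℕ j)
  edgeSet⁻ e = does-true (R? (toℕ i) (toℕ j)) (trans (sym at-edgeSet) e)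

Entry-edgeSet⁺ : ∀ {n} {R : ℕ → ℕ → Set} (R? : ∀ a b → Dec (R a b)) {a b} → a < n → b < n → R a b →
  Entry {n} (at (edgeSet R?)) a b
Entry-edgeSet⁺ {R = R} R? a<n b<n r =
  fromℕ< a<n , fromℕ< b<n , Fin.toℕ-fromℕ< a<n , Fin.toℕ-fromℕ< b<n ,
  edgeSet⁺ R? (subst₂ R (sym (Fin.toℕ-fromℕ< a<n)) (sym (Fin.toℕ-fromℕ< b<n)) r)

Entry-edgeSet⁻ : ∀ {n} {R : ℕ → ℕ → Set} (R? : ∀ a b → Dec (R a b)) {a b} →
  Entry {n} (at (edgeSet R?)) a b → R a b
Entry-edgeSet⁻ R? (i , j , refl , refl , Mij) = edgeSet⁻ R? Mij

edgeSet-sym : ∀ {n} {R : ℕ → ℕ → Set} (R? : ∀ a b → Dec (R a b)) → (∀ {a b} → R a b → R b a) →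
  ∀ (i j : Fin n) → at (edgeSet R?) i j ≡ at (edgeSet R?) j i
edgeSet-sym R? R-sym i j = begin
  at (edgeSet R?) i j            ≡⟨ at-edgeSet R? ⟩
  does (R? (toℕ i) (toℕ j))      ≡⟨ does-⇔ (mk⇔ R-sym R-sym) (R? (toℕ i) (toℕ j)) (R? (toℕ j) (toℕ i)) ⟩
  does (R? (toℕ j) (toℕ i))      ≡⟨ at-edgeSet R? ⟨
  at (edgeSet R?) j i            ∎
  where open ≡-Reasoning

record PerfectMatching (m : ℕ) (R : ℕ → ℕ → Set) : Set where
  field
    decide     : ∀ a b → Dec (R a b)
    functional : ∀ {a b b'} → R a b → R a b' → b ≡ b'
    injective  : ∀ {a a' b} → R a b → R a' b → a ≡ a'
    total      : ∀ {a} → a < m → Σ ℕ (R a)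
    onto       : ∀ {b} → b < m → Σ ℕ λ a → R a b
    bounded    : ∀ {a b} → R a b → a < m × b < m

module EdgeSetOfPerfectMatching {n m R} (pm : PerfectMatching m R) (m≤n : m ≤ n) where
  open PerfectMatching pm

  M : EdgeSet n
  M = edgeSet decide

  row≤1 : ∀ i → countB (at M i) ≤ 1
  row≤1 i = unique⇒countB≤1 (at M i) λ Mij Mij' →
    Fin.toℕ-injective (functional (edgeSet⁻ decide Mij) (edgeSet⁻ decide Mij'))

  col≤1 : ∀ j → countB (λ i → at M i j) ≤ 1
  col≤1 j = unique⇒countB≤1 (λ i → at M i j) λ Mij Mi'j →
    Fin.toℕ-injective (injective (edgeSet⁻ decide Mij) (edgeSet⁻ decide Mi'j))

  nonempty-rows : countB (λ i → not (countB (at M i) ≡ᵇ 0)) ≡ m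
  nonempty-rows = ≤-antisym
    (countB-ub-interval _ 0 m λ i nonempty →
      let j , Mij = countB-witness (at M i) (nonzero⁻ _ nonempty)
      in z≤n , proj₁ (bounded (edgeSet⁻ decide Mij)))
    (countB-lb-interval _ 0 m m≤n λ i _ i<m →
      let b , r = total i<m
          j = fromℕ< (≤-trans (proj₂ (bounded r)) m≤n)
      in nonzero⁺ (countB-pos (at M i) j (edgeSet⁺ decide (subst (R (toℕ i)) (sym (Fin.toℕ-fromℕ< _)) r))))

  edges : sumF (λ i → countB (at M i)) ≡ m
  edges = trans (sumF≡countB-nonzero _ row≤1) nonempty-rows

Doubled : ℕ → (ℕ → ℕ → Set) → ℕ → ℕ → Set
Doubled m R a b = (m ≤ b × R a (b ∸ m)) ⊎ (m ≤ a × R b (a ∸ m))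

Doubled? : ∀ m {R : ℕ → ℕ → Set} → (∀ a b → Dec (R a b)) → ∀ a b → Dec (Doubled m R a b)
Doubled? m R? a b = ((m ≤? b) ×-dec R? a (b ∸ m)) ⊎-dec ((m ≤? a) ×-dec R? b (a ∸ m))

Doubled-sym : ∀ m R {a b} → Doubled m R a b → Doubled m R b a
Doubled-sym m R = swap

module _ {m R} (pm : PerfectMatching m R) where
  open PerfectMatching pm

  private
    upper-half : ∀ {b} → m ≤ b → b ∸ m < m → b < 2 * m
    upper-half {b} m≤b b∸m<m = subst₂ _<_ (m+[n∸m]≡n m≤b) (x+x≡2*x m) (+-monoʳ-< m b∸m<m)

    upper-half⁻¹ : ∀ {b} → m ≤ b → b < 2 * m → b ∸ m < m
    upper-half⁻¹ {b} m≤b b<2m =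
      +-cancelˡ-< m _ _ (subst₂ _<_ (sym (m+[n∸m]≡n m≤b)) (sym (x+x≡2*x m)) b<2m)

    lower-half : ∀ {a} → a < m → a < 2 * m
    lower-half a<m = ≤-trans a<m (subst (m ≤_) (x+x≡2*x m) (m≤m+n m m))

    functional₂ : ∀ {a b b'} → Doubled m R a b → Doubled m R a b' → b ≡ b'
    functional₂ (inj₁ (m≤b , r)) (inj₁ (m≤b' , r')) = ∸-cancelʳ-≡ m≤b m≤b' (functional r r')
    functional₂ (inj₁ (_ , r))   (inj₂ (m≤a , _))   = contradiction m≤a (<⇒≱ (proj₁ (bounded r)))
    functional₂ (inj₂ (m≤a , _)) (inj₁ (_ , r'))    = contradiction m≤a (<⇒≱ (proj₁ (bounded r')))
    functional₂ (inj₂ (_ , r))   (inj₂ (_ , r'))    = injective r r'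

    total₂ : ∀ {a} → a < 2 * m → Σ ℕ (Doubled m R a)
    total₂ {a} a<2m with a <? m
    ... | yes a<m = let b , r = total a<m in
                    m + b , inj₁ (m≤m+n m b , subst (R a) (sym (m+n∸m≡n m b)) r)
    ... | no  a≮m = let m≤a = ≮⇒≥ a≮m ; b , r = onto (upper-half⁻¹ m≤a a<2m) in
                    b , inj₂ (m≤a , r)

    bounded₂ : ∀ {a b} → Doubled m R a b → a < 2 * m × b < 2 * m
    bounded₂ (inj₁ (m≤b , r)) = lower-half (proj₁ (bounded r)) , upper-half m≤b (proj₂ (bounded r))
    bounded₂ (inj₂ (m≤a , r)) = upper-half m≤a (proj₂ (bounded r)) , lower-half (proj₁ (bounded r))

  doubled : PerfectMatching (2 * m) (Doubled m R)
  doubled = record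
    { decide     = Doubled? m decide
    ; functional = functional₂
    ; injective  = λ r r' → functional₂ (Doubled-sym m R r) (Doubled-sym m R r')
    ; total      = total₂
    ; onto       = λ b<2m → map₂ (Doubled-sym m R) (total₂ b<2m)
    ; bounded    = bounded₂
    }

OnCycleOrFixed : ℕ → (ℕ → ℕ → Set) → Set
OnCycleOrFixed k R = ∀ {a b} → R a b → (a ≤ k × CycleEdge k a b) ⊎ (k < a × b ≡ a)

Straight : ℕ → ℕ → ℕ → Set
Straight m a b = a < m × b ≡ a

Twisted : ℕ → ℕ → ℕ → ℕ → Set
Twisted k m a b = (a < k × b ≡ suc a) ⊎ (a ≡ k × b ≡ 0) ⊎ (k < a × a < m × b ≡ a)

straight : ∀ m → PerfectMatching m (Straight m)
straight m = record
  { decide     = λ a b → (a <? m) ×-dec (b ≟ a)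
  ; functional = λ { (_ , refl) (_ , refl) → refl }
  ; injective  = λ { (_ , refl) (_ , refl) → refl }
  ; total      = λ {a} a<m → a , a<m , refl
  ; onto       = λ {b} b<m → b , b<m , refl
  ; bounded    = λ { (a<m , refl) → a<m , a<m }
  }

straight-onCycleOrFixed : ∀ k m → OnCycleOrFixed k (Straight m)
straight-onCycleOrFixed k m {a} (_ , refl) with a ≤? k
... | yes a≤k = inj₁ (a≤k , inj₁ refl)
... | no  a≰k = inj₂ (≰⇒> a≰k , refl)

module _ {k m : ℕ} (k<m : k < m) where

  private
    functional : ∀ {a b b'} → Twisted k m a b → Twisted k m a b' → b ≡ b'
    functional (inj₁ (_ , refl))           (inj₁ (_ , refl))           = refl
    functional (inj₁ (a<k , _))            (inj₂ (inj₁ (refl , _)))    = contradiction a<k (<-irrefl refl)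
    functional (inj₁ (a<k , _))            (inj₂ (inj₂ (k<a , _)))     = contradiction k<a (<⇒≯ a<k)
    functional (inj₂ (inj₁ (refl , _)))    (inj₁ (a<k , _))            = contradiction a<k (<-irrefl refl)
    functional (inj₂ (inj₁ (_ , refl)))    (inj₂ (inj₁ (_ , refl)))    = refl
    functional (inj₂ (inj₁ (refl , _)))    (inj₂ (inj₂ (k<k , _)))     = contradiction k<k (<-irrefl refl)
    functional (inj₂ (inj₂ (k<a , _)))     (inj₁ (a<k , _))            = contradiction k<a (<⇒≯ a<k)
    functional (inj₂ (inj₂ (k<k , _)))     (inj₂ (inj₁ (refl , _)))    = contradiction k<k (<-irrefl refl)
    functional (inj₂ (inj₂ (_ , _ , refl))) (inj₂ (inj₂ (_ , _ , refl))) = refl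

    injective : ∀ {a a' b} → Twisted k m a b → Twisted k m a' b → a ≡ a'
    injective (inj₁ (_ , refl))            (inj₁ (_ , e))               = suc-injective e
    injective (inj₁ (_ , refl))            (inj₂ (inj₁ (_ , ())))
    injective (inj₁ (a<k , refl))          (inj₂ (inj₂ (k<a' , _ , refl))) = contradiction (s≤s⁻¹ k<a') (<⇒≱ a<k)
    injective (inj₂ (inj₁ (_ , refl)))     (inj₁ (_ , ()))
    injective (inj₂ (inj₁ (refl , _)))     (inj₂ (inj₁ (refl , _)))     = refl
    injective (inj₂ (inj₁ (_ , refl)))     (inj₂ (inj₂ (() , _ , refl)))
    injective (inj₂ (inj₂ (k<a , _ , refl))) (inj₁ (a'<k , e))          =
      contradiction (subst (_≤ k) (sym e) a'<k) (<⇒≱ k<a)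
    injective (inj₂ (inj₂ (() , _ , refl))) (inj₂ (inj₁ (_ , refl)))
    injective (inj₂ (inj₂ (_ , _ , refl))) (inj₂ (inj₂ (_ , _ , refl))) = refl

    total : ∀ {a} → a < m → Σ ℕ (Twisted k m a)
    total {a} a<m with <-cmp a k
    ... | tri< a<k _ _ = suc a , inj₁ (a<k , refl)
    ... | tri≈ _ a≡k _ = 0 , inj₂ (inj₁ (a≡k , refl))
    ... | tri> _ _ k<a = a , inj₂ (inj₂ (k<a , a<m , refl))

    onto : ∀ {b} → b < m → Σ ℕ λ a → Twisted k m a b
    onto {zero}  _   = k , inj₂ (inj₁ (refl , refl))
    onto {suc b} b<m with b <? k
    ... | yes b<k = b , inj₁ (b<k , refl)
    ... | no  b≮k = suc b , inj₂ (inj₂ (s≤s (≮⇒≥ b≮k) , b<m , refl))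

    bounded : ∀ {a b} → Twisted k m a b → a < m × b < m
    bounded (inj₁ (a<k , refl))          = <-trans a<k k<m , ≤-trans (s≤s a<k) k<m
    bounded (inj₂ (inj₁ (refl , refl)))  = k<m , ≤-<-trans z≤n k<m
    bounded (inj₂ (inj₂ (_ , a<m , refl))) = a<m , a<m

  twisted : PerfectMatching m (Twisted k m)
  twisted = record
    { decide     = λ a b → ((a <? k) ×-dec (b ≟ suc a)) ⊎-dec
                           (((a ≟ k) ×-dec (b ≟ 0)) ⊎-dec ((k <? a) ×-dec ((a <? m) ×-dec (b ≟ a))))
    ; functional = functional
    ; injective  = injective
    ; total      = total
    ; onto       = onto
    ; bounded    = bounded
    }

twisted-onCycleOrFixed : ∀ k m → OnCycleOrFixed k (Twisted k m)
twisted-onCycleOrFixed k m (inj₁ (a<k , b≡a+1))       = inj₁ (<⇒≤ a<k , inj₂ (inj₁ (a<k , b≡a+1)))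
twisted-onCycleOrFixed k m (inj₂ (inj₁ (refl , b≡0))) = inj₁ (≤-refl , inj₂ (inj₂ (refl , b≡0)))
twisted-onCycleOrFixed k m (inj₂ (inj₂ (k<a , _ , b≡a))) = inj₂ (k<a , b≡a)

twisted-moves-0 : ∀ {k m} → 1 ≤ k → ¬ Twisted k m 0 0
twisted-moves-0 1≤k (inj₂ (inj₁ (0≡k , _))) = <⇒≢ 1≤k 0≡k

-- The cycle on {0, …, k} ∪ {m, …, m + k} together with hubs k < a < m joined to every other vertex.
module GraphConstruction (k m n : ℕ) (1≤k : 1 ≤ k) (k<m : k < m) (2m≤n : 2 * m ≤ n) where

  Hub : ℕ → Set
  Hub a = k < a × a < m

  Hub? : ∀ a → Dec (Hub a)
  Hub? a = (k <? a) ×-dec (a <? m)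

  OnCycle : ℕ → ℕ → Set
  OnCycle a b = a ≤ k × CycleEdge k a b

  Adjacent : ℕ → ℕ → Set
  Adjacent a b = Doubled m OnCycle a b ⊎ (Hub a × a ≢ b) ⊎ (Hub b × a ≢ b)

  Adjacent? : ∀ a b → Dec (Adjacent a b)
  Adjacent? a b = Doubled? m (λ a b → (a ≤? k) ×-dec CycleEdge? k a b) a b ⊎-dec
                  ((Hub? a ×-dec ¬? (a ≟ b)) ⊎-dec (Hub? b ×-dec ¬? (a ≟ b)))

  Adjacent-sym : ∀ {a b} → Adjacent a b → Adjacent b a
  Adjacent-sym (inj₁ d)                = inj₁ (Doubled-sym m OnCycle d)
  Adjacent-sym (inj₂ (inj₁ (h , a≢b))) = inj₂ (inj₂ (h , a≢b ∘ sym))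
  Adjacent-sym (inj₂ (inj₂ (h , a≢b))) = inj₂ (inj₁ (h , a≢b ∘ sym))

  Adjacent-irrefl : ∀ {a} → ¬ Adjacent a a
  Adjacent-irrefl (inj₁ (inj₁ (m≤a , a≤k , _))) = <⇒≱ (≤-<-trans a≤k k<m) m≤a
  Adjacent-irrefl (inj₁ (inj₂ (m≤a , a≤k , _))) = <⇒≱ (≤-<-trans a≤k k<m) m≤a
  Adjacent-irrefl (inj₂ (inj₁ (_ , a≢a)))        = a≢a refl
  Adjacent-irrefl (inj₂ (inj₂ (_ , a≢a)))        = a≢a refl

  G : SimpleGraph n
  G = record
    { adj   = λ i j → does (Adjacent? (toℕ i) (toℕ j))
    ; sym   = λ i j → does-⇔ (mk⇔ Adjacent-sym Adjacent-sym) (Adjacent? _ _) (Adjacent? _ _)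
    ; irrfl = λ i → dec-false (Adjacent? (toℕ i) (toℕ i)) Adjacent-irrefl
    }

  adjacent⁺ : ∀ {i j} → Adjacent (toℕ i) (toℕ j) → adj G i j ≡ true
  adjacent⁺ = dec-true (Adjacent? _ _)

  adjacent⁻ : ∀ {i j} → adj G i j ≡ true → Adjacent (toℕ i) (toℕ j)
  adjacent⁻ = does-true (Adjacent? _ _)

  private
    m+m≤n : m + m ≤ n
    m+m≤n = subst (_≤ n) (sym (x+x≡2*x m)) 2m≤n

    0<m : 0 < m
    0<m = ≤-<-trans z≤n k<m

    m<n : m < n
    m<n = <-≤-trans (m<m+n m 0<m) m+m≤n

    m≤n : m ≤ n
    m≤n = <⇒≤ m<n

  min-degree : MinDegreeAtLeast G (m ∸ (k + 1))
  min-degree i with Hub? (toℕ i)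
  ... | yes hub = ≤-trans (m∸n≤m m (k + 1)) (countB-lb-interval (adj G i) m m m+m≤n
      λ j m≤j _ → adjacent⁺ (inj₂ (inj₁ (hub , λ i≡j → <⇒≱ (proj₂ hub) (subst (m ≤_) (sym i≡j) m≤j)))))
  ... | no ¬hub = countB-lb-interval (adj G i) (suc k) (m ∸ (k + 1)) (≤-trans (≤-reflexive K+s≡m) m≤n)
      λ j k<j j<K+s → let hub = k<j , subst (toℕ j <_) K+s≡m j<K+s in
        adjacent⁺ (inj₂ (inj₂ (hub , λ i≡j → ¬hub (subst Hub (sym i≡j) hub))))
    where
    K+s≡m : suc k + (m ∸ (k + 1)) ≡ m
    K+s≡m = 1+k+[m∸[k+1]]≡m k<m

  HubOrUpper : ℕ → Set
  HubOrUpper a = k < a × a < suc k + m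

  HubOrUpper? : ∀ a → Dec (HubOrUpper a)
  HubOrUpper? a = (k <? a) ×-dec (a <? suc k + m)

  -- 1 on the cycle, 2 on the hubs, 0 elsewhere
  weight : ℕ → ℕ
  weight a = ι (does (a <? m)) + ι (does (HubOrUpper? a))

  weight-cycle : ∀ {a} → a ≤ k → weight a ≡ 1
  weight-cycle {a} a≤k rewrite ι-yes (a <? m) (≤-<-trans a≤k k<m)
                             | ι-no (HubOrUpper? a) (λ (k<a , _) → <⇒≱ k<a a≤k) = refl

  weight-hub : ∀ {a} → Hub a → weight a ≡ 2
  weight-hub {a} (k<a , a<m) rewrite ι-yes (a <? m) a<m
                                   | ι-yes (HubOrUpper? a) (k<a , ≤-trans a<m (m≤n+m m (suc k))) = refl

  weight-upper : ∀ {b} → m ≤ b → b ∸ m ≤ k → 1 ≤ weight b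
  weight-upper {b} m≤b b∸m≤k =
    ≤-trans (≤-reflexive (sym (ι-yes (HubOrUpper? b) (k<b , b<K+m)))) (m≤n+m _ _)
    where
    k<b : k < b
    k<b = <-≤-trans k<m m≤b
    b<K+m : b < suc k + m
    b<K+m = subst₂ _<_ (m+[n∸m]≡n m≤b) (+-comm m (suc k)) (+-monoʳ-< m (s≤s b∸m≤k))

  private
    cross-weight : ∀ {a b} → m ≤ b → OnCycle a (b ∸ m) → 2 ≤ weight a + weight b
    cross-weight {a} {b} m≤b (a≤k , ce) rewrite weight-cycle a≤k =
      s≤s (weight-upper m≤b (CycleEdge-≤ a≤k ce))

  edge-weight : ∀ {a b} → Adjacent a b → 2 ≤ weight a + weight b
  edge-weight (inj₁ (inj₁ (m≤b , c))) = cross-weight m≤b c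
  edge-weight {a} {b} (inj₁ (inj₂ (m≤a , c))) =
    subst (2 ≤_) (+-comm (weight b) (weight a)) (cross-weight m≤a c)
  edge-weight {a} {b} (inj₂ (inj₁ (hub , _))) =
    ≤-trans (≤-reflexive (sym (weight-hub hub))) (m≤m+n (weight a) (weight b))
  edge-weight {a} {b} (inj₂ (inj₂ (hub , _))) =
    ≤-trans (≤-reflexive (sym (weight-hub hub))) (m≤n+m (weight b) (weight a))

  total-weight : sumF {n} (weight ∘ toℕ) ≤ 2 * m
  total-weight = begin
    sumF {n} (weight ∘ toℕ)              ≡⟨ sumF-distrib-+ (ι ∘ below) (ι ∘ upper) ⟩
    sumF (ι ∘ below) + sumF (ι ∘ upper)  ≡⟨ cong₂ _+_ (countB≡sumF below) (countB≡sumF upper) ⟨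
    countB below + countB upper          ≤⟨ +-mono-≤ below≤m upper≤m ⟩
    m + m                                ≡⟨ x+x≡2*x m ⟩
    2 * m                                ∎
    where
    open ≤-Reasoning
    below upper : Fin n → Bool
    below i = does (toℕ i <? m)
    upper i = does (HubOrUpper? (toℕ i))
    below≤m : countB below ≤ m
    below≤m = countB-does-ub {n} (_<? m) 0 m (z≤n ,_)
    upper≤m : countB upper ≤ m
    upper≤m = countB-does-ub {n} HubOrUpper? (suc k) m (λ h → h)

  private
    cycle-partner : ∀ {a b} → Adjacent a b → a ≤ k → weight b ≤ 1 →
      Σ ℕ λ c → b ≡ m + c × CycleEdge k a c
    cycle-partner (inj₁ (inj₁ (m≤b , _ , ce)))   _   _ = _ , sym (m+[n∸m]≡n m≤b) , ce
    cycle-partner (inj₁ (inj₂ (m≤a , _)))        a≤k _ = contradiction m≤a (<⇒≱ (≤-<-trans a≤k k<m))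
    cycle-partner (inj₂ (inj₁ ((k<a , _) , _)))  a≤k _ = contradiction k<a (≤⇒≯ a≤k)
    cycle-partner (inj₂ (inj₂ (hub , _)))        _   w≤1 =
      contradiction (subst (_≤ 1) (weight-hub hub) w≤1) λ { (s≤s ()) }

  module _ (M : EdgeSet n) (vM : IsHVertex G (2 * m) M) where

    vertex-row≤1 : ∀ i → countB (at M i) ≤ 1
    vertex-row≤1 = proj₂ (proj₂ (proj₁ vM))

    vertex-col≤1 : ∀ j → countB (λ i → at M i j) ≤ 1
    vertex-col≤1 j = subst (_≤ 1) (countB-cong λ i → proj₁ (proj₁ vM) j i) (vertex-row≤1 j)

    private
      M⊆G : ∀ {i j} → at M i j ≡ true → Adjacent (toℕ i) (toℕ j)
      M⊆G Mij = adjacent⁻ (proj₁ (proj₂ (proj₁ vM)) _ _ Mij)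

      light : sumF {n} (weight ∘ toℕ) + sumF {n} (weight ∘ toℕ) ≤ 2 * sumF (λ i → countB (at M i))
      light = begin
        sumF {n} (weight ∘ toℕ) + sumF {n} (weight ∘ toℕ) ≤⟨ +-mono-≤ total-weight total-weight ⟩
        2 * m + 2 * m                             ≡⟨ x+x≡2*x (2 * m) ⟩
        2 * (2 * m)                               ≡⟨ cong (2 *_) (trans (sym (proj₂ vM))
                                                       (sym (sumF≡countB-nonzero _ vertex-row≤1))) ⟩
        2 * sumF (λ i → countB (at M i))          ∎
        where open ≤-Reasoning

    open CoverSlackness (at M) (weight ∘ toℕ) (weight ∘ toℕ) 2 (edge-weight ∘ M⊆G)
      vertex-row≤1 vertex-col≤1 light

    vertex-perfect : ∀ {a} → a ≤ k → Σ ℕ λ b → Entry (at M) a (m + b) × CycleEdge k a b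
    vertex-perfect {a} a≤k = c , (i , j , Fin.toℕ-fromℕ< a<n , j≡m+c , Mij) , ce
      where
      a<n = ≤-<-trans a≤k (<-≤-trans k<m m≤n)
      i = fromℕ< a<n
      weight-i : weight (toℕ i) ≡ 1
      weight-i = trans (cong weight (Fin.toℕ-fromℕ< a<n)) (weight-cycle a≤k)
      matched = countB-witness (at M i) (saturated (≤-reflexive (sym weight-i)))
      j = proj₁ matched
      Mij = proj₂ matched
      partner = cycle-partner (subst (λ x → Adjacent x (toℕ j)) (Fin.toℕ-fromℕ< a<n) (M⊆G Mij)) a≤k
        (+-cancelˡ-≤ 1 _ _ (subst (λ w → w + weight (toℕ j) ≤ 2) weight-i (tight Mij)))
      c = proj₁ partner
      j≡m+c = proj₁ (proj₂ partner)
      ce = proj₂ (proj₂ partner)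

  private
    Doubled⊆Adjacent : ∀ {R} → PerfectMatching m R → OnCycleOrFixed k R →
      ∀ {a b} → Doubled m R a b → Adjacent a b
    Doubled⊆Adjacent {R} pm onCycle (inj₁ d) = cross d
      where
      cross : ∀ {a b} → m ≤ b × R a (b ∸ m) → Adjacent a b
      cross (m≤b , r) with onCycle r
      ... | inj₁ c = inj₁ (inj₁ (m≤b , c))
      ... | inj₂ (k<a , _) = let a<m = proj₁ (PerfectMatching.bounded pm r) in
        inj₂ (inj₁ ((k<a , a<m) , λ a≡b → <⇒≱ a<m (subst (m ≤_) (sym a≡b) m≤b)))
    Doubled⊆Adjacent pm onCycle (inj₂ d) = Adjacent-sym (Doubled⊆Adjacent pm onCycle (inj₁ d))

    hVertex : ∀ {R} (pm : PerfectMatching m R) → OnCycleOrFixed k R →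
      IsHVertex G (2 * m) (EdgeSetOfPerfectMatching.M (doubled pm) 2m≤n)
    hVertex {R} pm onCycle =
      ( edgeSet-sym (Doubled? m decide) (Doubled-sym m R)
      , (λ i j Mij → adjacent⁺ (Doubled⊆Adjacent pm onCycle (edgeSet⁻ (Doubled? m decide) Mij)))
      , row≤1 )
      , nonempty-rows
      where
      open EdgeSetOfPerfectMatching (doubled pm) 2m≤n
      open PerfectMatching pm using (decide)

    open CycleSeparation k m 1≤k (<-trans k<m m<n) m<n (IsHVertex G (2 * m))
      vertex-row≤1 vertex-col≤1 vertex-perfect (λ i j → toℕ i <ᵇ toℕ j)
      (λ i≤k m≤j → Equivalence.to Bool.T-≡ (<⇒<ᵇ (≤-<-trans i≤k (<-≤-trans k<m m≤j))))

  disconnected-graph : Σ (SimpleGraph n) λ G →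
    MinDegreeAtLeast G (m ∸ (k + 1)) × HDisconnected G (2 * m) k
  disconnected-graph = G , min-degree , edgeSet straight? , edgeSet twisted? ,
    hVertex (straight m) (straight-onCycleOrFixed k m) ,
    hVertex (twisted k<m) (twisted-onCycleOrFixed k m) ,
    disconnected (λ (v , v' , _ , small) → v , v' , small)
      (Entry-edgeSet⁺ straight? (≤-<-trans z≤n m<n) m<n (inj₁ (≤-refl , 0<m , n∸n≡0 m)))
      (twisted-avoids-origin ∘ Entry-edgeSet⁻ twisted?)
    where
    straight? = PerfectMatching.decide (doubled (straight m))
    twisted?  = PerfectMatching.decide (doubled (twisted k<m))
    twisted-avoids-origin : ¬ Doubled m (Twisted k m) 0 m
    twisted-avoids-origin (inj₁ (_ , t))   = twisted-moves-0 1≤k (subst (Twisted k m 0) (n∸n≡0 m) t)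
    twisted-avoids-origin (inj₂ (m≤0 , _)) = <⇒≱ 0<m m≤0

-- Left vertices a ≤ k and right vertices b ≤ k form the cycle; left hubs k < a < L and
-- right hubs L ≤ b < m are joined to the whole other side.
module BipartiteConstruction (k m n : ℕ) (1≤k : 1 ≤ k) (k<m : k < m) (m≤n : m ≤ n) where

  d : ℕ
  d = (m ∸ (k + 1)) / 2

  L : ℕ
  L = suc k + d

  private
    0<m : 0 < m
    0<m = ≤-<-trans z≤n k<m

    0<n : 0 < n
    0<n = <-≤-trans 0<m m≤n

    d≤m∸[k+1] : d ≤ m ∸ (k + 1)
    d≤m∸[k+1] = m/n≤m (m ∸ (k + 1)) 2

    L≤m : L ≤ m
    L≤m = ≤-trans (+-monoʳ-≤ (suc k) d≤m∸[k+1]) (≤-reflexive (1+k+[m∸[k+1]]≡m k<m))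

    L+[m∸L]≡m : L + (m ∸ L) ≡ m
    L+[m∸L]≡m = m+[n∸m]≡n L≤m

    d≤m∸L : d ≤ m ∸ L
    d≤m∸L = subst (d ≤_) m∸[k+1]∸d≡m∸L (m+n≤o⇒m≤o∸n d d+d≤m∸[k+1])
      where
      d+d≤m∸[k+1] : d + d ≤ m ∸ (k + 1)
      d+d≤m∸[k+1] = subst (_≤ m ∸ (k + 1)) (trans (*-comm d 2) (sym (x+x≡2*x d)))
                            (m/n*n≤m (m ∸ (k + 1)) 2)
      m∸[k+1]∸d≡m∸L : m ∸ (k + 1) ∸ d ≡ m ∸ L
      m∸[k+1]∸d≡m∸L = trans (∸-+-assoc m (k + 1) d) (cong (λ x → m ∸ (x + d)) (+-comm k 1))

  RightHub : ℕ → Set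
  RightHub b = L ≤ b × b < m

  RightHub? : ∀ b → Dec (RightHub b)
  RightHub? b = (L ≤? b) ×-dec (b <? m)

  Pattern : ℕ → ℕ → Set
  Pattern a b = (a ≤ k × CycleEdge k a b) ⊎ (k < a × a < L) ⊎ RightHub b

  Pattern? : ∀ a b → Dec (Pattern a b)
  Pattern? a b =
    ((a ≤? k) ×-dec CycleEdge? k a b) ⊎-dec (((k <? a) ×-dec (a <? L)) ⊎-dec RightHub? b)

  G : BipGraph n
  G i j = does (Pattern? (toℕ i) (toℕ j))

  min-degree : BipMinDegreeAtLeast G d
  min-degree = left , right
    where
    left : ∀ i → d ≤ degLeft G i
    left i = ≤-trans d≤m∸L (countB-lb-interval (G i) L (m ∸ L) (≤-trans (≤-reflexive L+[m∸L]≡m) m≤n)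
      λ j L≤j j<m → dec-true (Pattern? (toℕ i) (toℕ j))
                             (inj₂ (inj₂ (L≤j , subst (toℕ j <_) L+[m∸L]≡m j<m))))
    right : ∀ j → d ≤ degRight G j
    right j = countB-lb-interval (λ i → G i j) (suc k) d (≤-trans L≤m m≤n)
      λ i k<i i<L → dec-true (Pattern? (toℕ i) (toℕ j)) (inj₂ (inj₁ (k<i , i<L)))

  -- the left vertices below L and the right hubs: a vertex cover of size m
  left-weight right-weight : ℕ → ℕ
  left-weight a  = ι (does (a <? L))
  right-weight b = ι (does (RightHub? b))

  pattern-covered : ∀ {a b} → Pattern a b → 1 ≤ left-weight a + right-weight b
  pattern-covered {a} {b} (inj₁ (a≤k , _)) =
    ≤-trans (≤-reflexive (sym (ι-yes (a <? L) (≤-<-trans a≤k (m≤m+n (suc k) d))))) (m≤m+n _ _)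
  pattern-covered {a} {b} (inj₂ (inj₁ (_ , a<L))) =
    ≤-trans (≤-reflexive (sym (ι-yes (a <? L) a<L))) (m≤m+n _ _)
  pattern-covered {a} {b} (inj₂ (inj₂ hub)) =
    ≤-trans (≤-reflexive (sym (ι-yes (RightHub? b) hub))) (m≤n+m _ _)

  total-weight : sumF {n} (left-weight ∘ toℕ) + sumF {n} (right-weight ∘ toℕ) ≤ m
  total-weight = begin
    sumF (ι ∘ left) + sumF (ι ∘ right)  ≡⟨ cong₂ _+_ (countB≡sumF left) (countB≡sumF right) ⟨
    countB left + countB right          ≤⟨ +-mono-≤ left≤L right≤m∸L ⟩
    L + (m ∸ L)                         ≡⟨ L+[m∸L]≡m ⟩
    m                                   ∎
    where
    open ≤-Reasoning
    left right : Fin n → Bool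
    left i  = does (toℕ i <? L)
    right j = does (RightHub? (toℕ j))
    left≤L : countB left ≤ L
    left≤L = countB-does-ub {n} (_<? L) 0 L (z≤n ,_)
    right≤m∸L : countB right ≤ m ∸ L
    right≤m∸L = countB-does-ub {n} RightHub? L (m ∸ L) λ (L≤b , b<m) → L≤b , subst (_ <_) (sym L+[m∸L]≡m) b<m

  module _ (M : EdgeSet n) (vM : IsBipHVertex G m M) where

    vertex-row≤1 : ∀ i → countB (at M i) ≤ 1
    vertex-row≤1 = proj₁ (proj₂ (proj₁ vM))

    vertex-col≤1 : ∀ j → countB (λ i → at M i j) ≤ 1
    vertex-col≤1 = proj₂ (proj₂ (proj₁ vM))

    private
      M⊆G : ∀ {i j} → at M i j ≡ true → Pattern (toℕ i) (toℕ j)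
      M⊆G Mij = does-true (Pattern? _ _) (proj₁ (proj₁ vM) _ _ Mij)

      light : sumF {n} (left-weight ∘ toℕ) + sumF {n} (right-weight ∘ toℕ) ≤
              1 * sumF (λ i → countB (at M i))
      light = ≤-trans total-weight (≤-reflexive (trans (sym (proj₂ vM)) (sym (*-identityˡ _))))

    open CoverSlackness (at M) (left-weight ∘ toℕ) (right-weight ∘ toℕ) 1 (pattern-covered ∘ M⊆G)
      vertex-row≤1 vertex-col≤1 light

    vertex-perfect : ∀ {a} → a ≤ k → Σ ℕ λ b → Entry (at M) a (0 + b) × CycleEdge k a b
    vertex-perfect {a} a≤k = on-cycle (M⊆G Mij)
      where
      a<n = ≤-<-trans a≤k (<-≤-trans k<m m≤n)
      i = fromℕ< a<n
      left-weight-i : left-weight (toℕ i) ≡ 1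
      left-weight-i = ι-yes (toℕ i <? L)
        (subst (_< L) (sym (Fin.toℕ-fromℕ< a<n)) (≤-<-trans a≤k (m≤m+n (suc k) d)))
      matched = countB-witness (at M i) (saturated (≤-reflexive (sym left-weight-i)))
      j = proj₁ matched
      Mij = proj₂ matched
      on-cycle : Pattern (toℕ i) (toℕ j) → Σ ℕ λ b → Entry (at M) a (0 + b) × CycleEdge k a b
      on-cycle (inj₁ (_ , ce))         =
        toℕ j , (i , j , Fin.toℕ-fromℕ< a<n , refl , Mij) ,
        subst (λ x → CycleEdge k x (toℕ j)) (Fin.toℕ-fromℕ< a<n) ce
      on-cycle (inj₂ (inj₁ (k<a , _))) = contradiction (subst (k <_) (Fin.toℕ-fromℕ< a<n) k<a) (≤⇒≯ a≤k)
      on-cycle (inj₂ (inj₂ hub))       = contradiction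
        (subst (λ w → w + right-weight (toℕ j) ≤ 1) left-weight-i (tight Mij))
        (subst (λ w → ¬ 1 + w ≤ 1) (sym (ι-yes (RightHub? (toℕ j)) hub)) λ { (s≤s ()) })

  private
    R⊆Pattern : ∀ {R} → PerfectMatching m R → OnCycleOrFixed k R →
      ∀ {a b} → R a b → Pattern a b
    R⊆Pattern pm onCycle r with onCycle r
    ... | inj₁ c = inj₁ c
    ... | inj₂ (k<a , refl) with _ <? L
    ...   | yes a<L = inj₂ (inj₁ (k<a , a<L))
    ...   | no  a≮L = inj₂ (inj₂ (≮⇒≥ a≮L , proj₂ (PerfectMatching.bounded pm r)))

    hVertex : ∀ {R} (pm : PerfectMatching m R) → OnCycleOrFixed k R →
      IsBipHVertex G m (EdgeSetOfPerfectMatching.M pm m≤n)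
    hVertex pm onCycle =
      ( (λ i j Mij → dec-true (Pattern? (toℕ i) (toℕ j))
                       (R⊆Pattern pm onCycle (edgeSet⁻ (PerfectMatching.decide pm) Mij)))
      , row≤1 , col≤1 )
      , edges
      where open EdgeSetOfPerfectMatching pm m≤n

    open CycleSeparation k 0 1≤k (<-≤-trans k<m m≤n) 0<n (IsBipHVertex G m)
      vertex-row≤1 vertex-col≤1 vertex-perfect (λ _ _ → true) (λ _ _ → refl)

  disconnected-graph : Σ (BipGraph n) λ G →
    BipMinDegreeAtLeast G ((m ∸ (k + 1)) / 2) × BipHDisconnected G m k
  disconnected-graph = G , min-degree , edgeSet straight? , edgeSet twisted? ,
    hVertex (straight m) (straight-onCycleOrFixed k m) ,
    hVertex (twisted k<m) (twisted-onCycleOrFixed k m) ,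
    disconnected (λ (v , v' , _ , small) → v , v' , small)
      (Entry-edgeSet⁺ straight? 0<n 0<n (0<m , refl))
      (twisted-moves-0 1≤k ∘ Entry-edgeSet⁻ twisted?)
    where
    straight? = PerfectMatching.decide (straight m)
    twisted?  = PerfectMatching.decide (twisted k<m)

corollary4p6 :
    ((k n m : ℕ) → 2 ≤ k → 1 ≤ n → k < m → 2 * m ≤ n →
      Σ (SimpleGraph n) λ G →
        MinDegreeAtLeast G (m ∸ (k + 1)) × HDisconnected G (2 * m) k)
    ×
    ((k n m : ℕ) → 2 ≤ k → 1 ≤ n → k < m → m ≤ n →
      Σ (BipGraph n) λ G →
        BipMinDegreeAtLeast G ((m ∸ (k + 1)) / 2) × BipHDisconnected G m k)
corollary4p6 =
  (λ k n m 2≤k _ k<m 2m≤n → GraphConstruction.disconnected-graph k m n (<⇒≤ 2≤k) k<m 2m≤n) ,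
  (λ k n m 2≤k _ k<m m≤n → BipartiteConstruction.disconnected-graph k m n (<⇒≤ 2≤k) k<m m≤n)
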